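{- Let $n\ge 3$ and $A\subseteq[n]$. If $n-1\in A$, then $f_n(A\setminus\{n-1\})\ge f_n(A)$. If $2\notin A$, then $f_n(A\cup\{2\})\ge f_n(A)$.
   Context: The set of alternatives is $[n]=\{1,\dots,n\}$ with its natural order. For a triple $i<j<k$, the never condition $1N3$ on a set of linear orders means that in every order, $i$ is not ranked last among $i,j,k$; $3N1$ means that $k$ is not ranked first among $i,j,k$. For $B\subseteq[n]$, the set-alternating scheme generated by $B$ assigns to each triple $i<j<k$ the condition $1N3$ if $j\in B$ and $3N1$ if $j\notin B$; $D_{[n]}(B)$ is the set of all linear orders on $[n]$ satisfying all assigned conditions, and $f_n(B)=|D_{[n]}(B)|$. -}

module Defs where

open import Data.Nat using (ℕ; zero; suc; _<ᵇ_)
open import Data.Bool using (Bool; true; false; _∧_; _∨_; not; if_then_else_)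
open import Data.Fin using (Fin; toℕ; _≟_)
open import Data.Fin.Subset using (Subset)
open import Data.Vec using (Vec; []; _∷_; lookup)
open import Data.List using (List; []; _∷_; map; concatMap; allFin; filterᵇ; length)
open import Data.Bool.ListAction using (all)
open import Relation.Nullary.Decidable using (⌊_⌋)

-- Alternatives [n] = {1,…,n} are represented by Fin n; the element i : Fin n
-- stands for the alternative  label i = toℕ i + 1.  The natural order on
-- [n] corresponds to the order of toℕ.
label : ∀ {n} → Fin n → ℕ
label i = suc (toℕ i)

-- A candidate linear order on [n] is given by its rank function
-- r : Fin n → Fin n (r x = position of x, 0 = ranked first),
-- stored as a vector.  It is a linear order iff r is injective
-- (hence a bijection, as the domain and codomain both have n elements).

allVec : (n k : ℕ) → List (Vec (Fin n) k)
allVec n zero    = [] ∷ []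
allVec n (suc k) = concatMap (λ x → map (x ∷_) (allVec n k)) (allFin n)

lt : ∀ {n} → Fin n → Fin n → Bool
lt a b = toℕ a <ᵇ toℕ b

isLinearOrder : ∀ {n} → Vec (Fin n) n → Bool
isLinearOrder {n} r =
  all (λ x → all (λ y → ⌊ x ≟ y ⌋ ∨ not ⌊ lookup r x ≟ lookup r y ⌋) (allFin n)) (allFin n)

cond1N3 : ∀ {n} → Vec (Fin n) n → Fin n → Fin n → Fin n → Bool
cond1N3 r i j k = not (lt (lookup r j) (lookup r i) ∧ lt (lookup r k) (lookup r i))

cond3N1 : ∀ {n} → Vec (Fin n) n → Fin n → Fin n → Fin n → Bool
cond3N1 r i j k = not (lt (lookup r k) (lookup r i) ∧ lt (lookup r k) (lookup r j))

satisfiesScheme : ∀ {n} → Subset n → Vec (Fin n) n → Bool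
satisfiesScheme {n} B r =
  all (λ i → all (λ j → all (λ k →
        not (lt i j ∧ lt j k)
        ∨ (if lookup B j then cond1N3 r i j k else cond3N1 r i j k))
      (allFin n)) (allFin n)) (allFin n)

-- D_[n](B) as a list of rank vectors (each linear order appears exactly once)
D : (n : ℕ) → Subset n → List (Vec (Fin n) n)
D n B = filterᵇ (λ r → isLinearOrder r ∧ satisfiesScheme B r) (allVec n n)

f : (n : ℕ) → Subset n → ℕ
f n B = length (D n B)

-- Write a = n-1 and c = n.  The only triples with middle element a are (i, a, c), so the
-- schemes of A and A ∖ {a} differ only there: 1N3 forbids i to be last, 3N1 forbids c to be
-- first.  Under 1N3 nothing may follow both a and c, so the later of a and c is ranked last;
-- hence an order of D(A) breaks a 3N1 condition only if c precedes a, a is last, and c is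
-- not immediately before a.  Moving a from the last place to just before c repairs it.  This
-- gives an injection D(A) → D(A ∖ {a}): a moved order has a right before c with c not last,
-- which is impossible in D(A).  The second claim is the first one for the dual scheme:
-- reversing each order and relabelling i ↦ n+1-i sends D(B) into D(B*), where j ∈ B* iff
-- n+1-j ∉ B, and this exchanges 2 with n-1 and adding with removing.
module Submission where

open import Defs
open import Data.Bool using (Bool; true; false; T; not; _∧_; _∨_; if_then_else_)
open import Data.Bool.Properties using (T-∧; T-∨; T?; not-involutive; ∨-identityʳ)
open import Data.Bool.ListAction using (all)
open import Data.Empty using (⊥-elim)
open import Data.Fin using (Fin; zero; suc; toℕ; fromℕ; fromℕ<; opposite; _≟_)
open import Data.Fin.Properties
  using (toℕ-injective; toℕ<n; toℕ≤pred[n]; toℕ-fromℕ; toℕ-fromℕ<; fromℕ<-injective; <⇒≢;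
         pigeonhole; opposite-prop; opposite-involutive)
open import Data.Fin.Subset using (Subset; _∈_; _∉_; _─_; _∪_; ⁅_⁆)
open import Data.Fin.Subset.Properties using (p─⊥≡p; ∪-identityʳ; x∈p∪q⁺; x∈⁅x⁆)
open import Data.List
  using (List; []; _∷_; _++_; map; concatMap; allFin; length; cartesianProductWith)
open import Data.List.Properties using (length-++; length-map)
open import Data.List.Membership.Propositional using () renaming (_∈_ to _∈ₗ_)
open import Data.List.Membership.Propositional.Properties
  using (∈-∃++; ∈-++⁻; ∈-++⁺ˡ; ∈-++⁺ʳ; ∈-map⁻; ∈-filter⁺; ∈-filter⁻; ∈-allFin;
         ∈-cartesianProductWith⁺)
open import Data.List.Relation.Binary.Subset.Propositional using (_⊆_)
open import Data.List.Relation.Unary.Any using (here; there)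
open import Data.List.Relation.Unary.All as All using ([])
open import Data.List.Relation.Unary.All.Properties using (all⁺; all⁻; map⁺)
open import Data.List.Relation.Unary.AllPairs using ([]; _∷_)
open import Data.List.Relation.Unary.Unique.Propositional using (Unique)
open import Data.List.Relation.Unary.Unique.Propositional.Properties as Unique using (allFin⁺)
open import Data.Nat
  using (ℕ; zero; suc; pred; _+_; _∸_; _⊔_; _≤_; _<_; _<?_; z≤n; s≤s; z<s; s<s; s≤s⁻¹; s<s⁻¹)
open import Data.Nat.DivMod using (_mod_; _%_; m<n⇒m%n≡m)
open import Data.Nat.Properties
  using (≤-refl; ≤-trans; ≤-antisym; <-trans; <-asym; <⇒≤; <⇒≱; ≤∧≢⇒<; ≮⇒≥; n<1+n; suc-injective;
         +-suc; ⊔-lub; m≤m⊔n; m≤n⊔m; m⊔n<o⇒m<o; m⊔n<o⇒n<o; m≥n⇒m⊔n≡m; m≤n⇒m⊔n≡n;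
         ∸-monoʳ-<; ∸-cancelʳ-<; <ᵇ⇒<; <⇒<ᵇ; module ≤-Reasoning)
  renaming (_≟_ to _≟ℕ_; <⇒≢ to <⇒≢ℕ)
open import Data.Product as Product using (_×_; _,_; proj₁; proj₂)
open import Data.Sum using (inj₁; inj₂)
open import Data.Unit using (tt)
open import Data.Vec using (Vec; []; _∷_; lookup; tabulate)
open import Data.Vec.Properties using (∷-injective; lookup∘tabulate; []=⇒lookup; lookup⇒[]=)
open import Data.Vec.Relation.Binary.Pointwise.Extensional using (ext; Pointwise-≡⇒≡)
open import Function using (_∘_; _⇔_; mk⇔; Equivalence; Injective)
open import Relation.Binary.PropositionalEquality
  using (_≡_; _≢_; _≗_; refl; sym; trans; cong; subst; subst₂; module ≡-Reasoning)
open import Relation.Nullary using (¬_; Dec; yes; no)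
open import Relation.Nullary.Decidable using (⌊_⌋; _×-dec_)

open Equivalence using (to; from)

allVec-cartesianProduct : ∀ n k →
  allVec n (suc k) ≡ cartesianProductWith _∷_ (allFin n) (allVec n k)
allVec-cartesianProduct n k = go (allFin n)
  where
  go : ∀ xs →
    concatMap (λ x → map (x ∷_) (allVec n k)) xs ≡ cartesianProductWith _∷_ xs (allVec n k)
  go []       = refl
  go (x ∷ xs) = cong (map (x ∷_) (allVec n k) ++_) (go xs)

allVec-unique : ∀ n k → Unique (allVec n k)
allVec-unique n zero    = [] ∷ []
allVec-unique n (suc k) rewrite allVec-cartesianProduct n k =
  Unique.cartesianProductWith⁺ _∷_ ∷-injective (allFin⁺ n) (allVec-unique n k)

∈-allVec : ∀ n k (v : Vec (Fin n) k) → v ∈ₗ allVec n k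
∈-allVec n zero    []      = here refl
∈-allVec n (suc k) (x ∷ v) rewrite allVec-cartesianProduct n k =
  ∈-cartesianProductWith⁺ _∷_ (∈-allFin x) (∈-allVec n k v)

module _ {A : Set} where

  unique∧⊆⇒length≤ : ∀ {xs ys : List A} → Unique xs → xs ⊆ ys → length xs ≤ length ys
  unique∧⊆⇒length≤ {[]}     _              _     = z≤n
  unique∧⊆⇒length≤ {x ∷ xs} (x∉xs ∷ xs-uniq) xs⊆ys with ∈-∃++ (xs⊆ys (here refl))
  ... | us , vs , refl = begin
    suc (length xs)          ≤⟨ s≤s (unique∧⊆⇒length≤ xs-uniq xs⊆us++vs) ⟩
    suc (length (us ++ vs))  ≡⟨ cong suc (length-++ us) ⟩
    suc (length us + length vs) ≡⟨ +-suc (length us) (length vs) ⟨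
    length us + length (x ∷ vs) ≡⟨ length-++ us ⟨
    length (us ++ x ∷ vs)    ∎
    where
    open ≤-Reasoning
    xs⊆us++vs : xs ⊆ us ++ vs
    xs⊆us++vs {y} y∈xs with ∈-++⁻ us (xs⊆ys (there y∈xs))
    ... | inj₁ y∈us         = ∈-++⁺ˡ y∈us
    ... | inj₂ (here refl)  = ⊥-elim (All.lookup x∉xs y∈xs refl)
    ... | inj₂ (there y∈vs) = ∈-++⁺ʳ us y∈vs

  unique-map⁺ : ∀ {B : Set} {xs} (g : A → B) →
    (∀ {x y} → x ∈ₗ xs → y ∈ₗ xs → g x ≡ g y → x ≡ y) → Unique xs → Unique (map g xs)
  unique-map⁺ g g-inj [] = []
  unique-map⁺ g g-inj (x∉xs ∷ xs-uniq) =
    map⁺ (All.tabulate λ y∈xs gx≡gy → All.lookup x∉xs y∈xs (g-inj (here refl) (there y∈xs) gx≡gy))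
    ∷ unique-map⁺ g (λ x∈ y∈ → g-inj (there x∈) (there y∈)) xs-uniq

rank : ∀ {n} → Vec (Fin n) n → Fin n → ℕ
rank r x = toℕ (lookup r x)

-- A ranking ρ gives the position of each alternative (0 = first).  Never true is 1N3 (the
-- first of the triple is not last), Never false is 3N1 (the last is not first).
Never : Bool → ℕ → ℕ → ℕ → Set
Never true  x y z = ¬ (y < x × z < x)
Never false x y z = ¬ (z < x × z < y)

Respects : ∀ {n} → Subset n → (Fin n → ℕ) → Set
Respects {n} B ρ = ∀ {i j k : Fin n} → toℕ i < toℕ j → toℕ j < toℕ k →
  Never (lookup B j) (ρ i) (ρ j) (ρ k)

Valid : ∀ {n} → Subset n → (Fin n → ℕ) → Set
Valid B ρ = Injective _≡_ _≡_ ρ × Respects B ρ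

T-not : ∀ {b} → T (not b) ⇔ (¬ T b)
T-not {false} = mk⇔ (λ _ ()) (λ _ → tt)
T-not {true}  = mk⇔ (λ ()) (λ ¬t → ¬t tt)

T-lt : ∀ {n} {u v : Fin n} → T (lt u v) ⇔ toℕ u < toℕ v
T-lt {u = u} {v} = mk⇔ (<ᵇ⇒< (toℕ u) (toℕ v)) <⇒<ᵇ

T-not-lt∧lt : ∀ {n} {u v w z : Fin n} →
  T (not (lt u v ∧ lt w z)) ⇔ (¬ (toℕ u < toℕ v × toℕ w < toℕ z))
T-not-lt∧lt = mk⇔
  (λ t (u<v , w<z) → to T-not t (from T-∧ (from T-lt u<v , from T-lt w<z)))
  (λ ¬lt → from T-not (λ t → let p , q = to T-∧ t in ¬lt (to T-lt p , to T-lt q)))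

T-all-allFin : ∀ {n} (p : Fin n → Bool) → T (all p (allFin n)) ⇔ (∀ i → T (p i))
T-all-allFin p = mk⇔
  (λ t i → All.lookup (all⁺ p (allFin _) t) (∈-allFin i))
  (λ h → all⁻ p {xs = allFin _} (All.tabulate (λ {i} _ → h i)))

T-never : ∀ {n} b (r : Vec (Fin n) n) i j k →
  T (if b then cond1N3 r i j k else cond3N1 r i j k) ⇔ Never b (rank r i) (rank r j) (rank r k)
T-never true  r i j k = T-not-lt∧lt
T-never false r i j k = T-not-lt∧lt

T-≟∨not≟ : ∀ {n} (x y u v : Fin n) → T (⌊ x ≟ y ⌋ ∨ not ⌊ u ≟ v ⌋) ⇔ (u ≡ v → x ≡ y)
T-≟∨not≟ x y u v with x ≟ y | u ≟ v
... | yes x≡y | _       = mk⇔ (λ _ _ → x≡y) (λ _ → tt)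
... | no x≢y  | yes u≡v = mk⇔ (λ ()) (λ u≡v⇒x≡y → x≢y (u≡v⇒x≡y u≡v))
... | no _    | no u≢v  = mk⇔ (λ _ u≡v → ⊥-elim (u≢v u≡v)) (λ _ → tt)

T-guarded : ∀ {n} (i j k : Fin n) c →
  T (not (lt i j ∧ lt j k) ∨ c) ⇔ (toℕ i < toℕ j → toℕ j < toℕ k → T c)
T-guarded i j k c = mk⇔ to′ from′
  where
  to′ : T (not (lt i j ∧ lt j k) ∨ c) → toℕ i < toℕ j → toℕ j < toℕ k → T c
  to′ t i<j j<k with to T-∨ t
  ... | inj₁ t′ = ⊥-elim (to T-not-lt∧lt t′ (i<j , j<k))
  ... | inj₂ tc = tc
  from′ : (toℕ i < toℕ j → toℕ j < toℕ k → T c) → T (not (lt i j ∧ lt j k) ∨ c)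
  from′ h with T? (lt i j ∧ lt j k)
  ... | yes t = from T-∨ (inj₂ (h (to T-lt (proj₁ (to T-∧ t))) (to T-lt (proj₂ (to T-∧ t)))))
  ... | no ¬t = from T-∨ (inj₁ (from T-not ¬t))

T-isLinearOrder : ∀ {n} (r : Vec (Fin n) n) → T (isLinearOrder r) ⇔ Injective _≡_ _≡_ (rank r)
T-isLinearOrder r = mk⇔
  (λ t {x} {y} rx≡ry →
    to (T-≟∨not≟ x y _ _) (to (T-all-allFin _) (to (T-all-allFin _) t x) y) (toℕ-injective rx≡ry))
  (λ inj → from (T-all-allFin _) λ x → from (T-all-allFin _) λ y →
    from (T-≟∨not≟ x y _ _) (λ e → inj {x} {y} (cong toℕ e)))

T-satisfiesScheme : ∀ {n} (B : Subset n) (r : Vec (Fin n) n) →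
  T (satisfiesScheme B r) ⇔ Respects B (rank r)
T-satisfiesScheme B r = mk⇔
  (λ t {i} {j} {k} i<j j<k → to (T-never (lookup B j) r i j k)
    (to (T-guarded i j k _) (at (at (at t i) j) k) i<j j<k))
  (λ resp → from (T-all-allFin _) λ i → from (T-all-allFin _) λ j → from (T-all-allFin _) λ k →
    from (T-guarded i j k _) λ i<j j<k → from (T-never (lookup B j) r i j k) (resp i<j j<k))
  where
  at : ∀ {n} {p : Fin n → Bool} → T (all p (allFin n)) → ∀ i → T (p i)
  at = to (T-all-allFin _)

T-isLinearOrder∧satisfiesScheme : ∀ {n} (B : Subset n) (r : Vec (Fin n) n) →
  T (isLinearOrder r ∧ satisfiesScheme B r) ⇔ Valid B (rank r)
T-isLinearOrder∧satisfiesScheme B r = mk⇔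
  (Product.map (to (T-isLinearOrder r)) (to (T-satisfiesScheme B r)) ∘ to T-∧)
  (from T-∧ ∘ Product.map (from (T-isLinearOrder r)) (from (T-satisfiesScheme B r)))

injection⇒f≤f : ∀ {n} {A B : Subset n} (g : Vec (Fin n) n → Vec (Fin n) n) →
  (∀ {r} → Valid A (rank r) → Valid B (rank (g r))) →
  (∀ {r s} → Valid A (rank r) → Valid A (rank s) → g r ≡ g s → r ≡ s) →
  f n A ≤ f n B
injection⇒f≤f {n} {A} {B} g g-valid g-inj = begin
  f n A                ≡⟨ length-map g (D n A) ⟨
  length (map g (D n A)) ≤⟨ unique∧⊆⇒length≤ g[DA]-unique g[DA]⊆DB ⟩
  f n B                ∎
  where
  open ≤-Reasoning
  valid : ∀ C {r} → r ∈ₗ D n C → Valid C (rank r)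
  valid C {r} r∈D = to (T-isLinearOrder∧satisfiesScheme C r)
    (proj₂ (∈-filter⁻ (T? ∘ _) {xs = allVec n n} r∈D))
  g[DA]-unique : Unique (map g (D n A))
  g[DA]-unique = unique-map⁺ g (λ r∈ s∈ → g-inj (valid A r∈) (valid A s∈))
    (Unique.filter⁺ (T? ∘ _) (allVec-unique n n))
  g[DA]⊆DB : map g (D n A) ⊆ D n B
  g[DA]⊆DB y∈ with ∈-map⁻ g y∈
  ... | r , r∈DA , refl = ∈-filter⁺ (T? ∘ _) (∈-allVec n n (g r))
    (from (T-isLinearOrder∧satisfiesScheme B (g r)) (g-valid (valid A r∈DA)))

Never-mono : ∀ b {x y z x′ y′ z′} →
  (y′ < x′ → y < x) → (z′ < x′ → z < x) → (z′ < y′ → z < y) →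
  Never b x y z → Never b x′ y′ z′
Never-mono true  yx zx zy never (y′<x′ , z′<x′) = never (yx y′<x′ , zx z′<x′)
Never-mono false yx zx zy never (z′<x′ , z′<y′) = never (zx z′<x′ , zy z′<y′)

Valid-resp-≗ : ∀ {n} {B : Subset n} {ρ ρ′ : Fin n → ℕ} → ρ ≗ ρ′ → Valid B ρ → Valid B ρ′
Valid-resp-≗ {B = B} {ρ} {ρ′} ρ≗ρ′ (inj , resp) =
  (λ {x} {y} e → inj (trans (ρ≗ρ′ x) (trans e (sym (ρ≗ρ′ y)))))
  , (λ {i} {j} {k} i<j j<k →
      Never-mono (lookup B j) (transport j i) (transport k i) (transport k j) (resp i<j j<k))
  where
  transport : ∀ x y → ρ′ x < ρ′ y → ρ x < ρ y
  transport x y = subst₂ _<_ (sym (ρ≗ρ′ x)) (sym (ρ≗ρ′ y))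

injective⇒≤bound : ∀ {n k} {ρ : Fin n → ℕ} → Injective _≡_ _≡_ ρ → (∀ x → ρ x < k) → n ≤ k
injective⇒≤bound {ρ = ρ} inj ρ<k = ≮⇒≥ λ k<n →
  let i , j , i<j , eq = pigeonhole k<n (λ x → fromℕ< (ρ<k x))
  in <⇒≢ i<j (inj (fromℕ<-injective (ρ i) (ρ j) (ρ<k i) (ρ<k j) eq))

punchIn : ℕ → ℕ → ℕ
punchIn zero    v       = suc v
punchIn (suc q) zero    = zero
punchIn (suc q) (suc v) = suc (punchIn q v)

punchIn-self : ∀ q → punchIn q q ≡ suc q
punchIn-self zero    = refl
punchIn-self (suc q) = cong suc (punchIn-self q)

punchInᵢ≢i : ∀ q v → punchIn q v ≢ q
punchInᵢ≢i zero    v       ()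
punchInᵢ≢i (suc q) zero    ()
punchInᵢ≢i (suc q) (suc v) e = punchInᵢ≢i q v (suc-injective e)

punchIn-injective : ∀ q {v w} → punchIn q v ≡ punchIn q w → v ≡ w
punchIn-injective zero    e = suc-injective e
punchIn-injective (suc q) {zero}  {zero}  e = refl
punchIn-injective (suc q) {suc v} {suc w} e = cong suc (punchIn-injective q (suc-injective e))

punchIn-cancel-< : ∀ q {v w} → punchIn q v < punchIn q w → v < w
punchIn-cancel-< zero    p = s<s⁻¹ p
punchIn-cancel-< (suc q) {zero}  {suc w} p = z<s
punchIn-cancel-< (suc q) {suc v} {suc w} p = s<s (punchIn-cancel-< q (s<s⁻¹ p))

i<punchIn⇒i≤ : ∀ q v → q < punchIn q v → q ≤ v
i<punchIn⇒i≤ zero    v       p = z≤n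
i<punchIn⇒i≤ (suc q) (suc v) p = s≤s (i<punchIn⇒i≤ q v (s<s⁻¹ p))

punchIn≤suc : ∀ q v → punchIn q v ≤ suc v
punchIn≤suc zero    v       = ≤-refl
punchIn≤suc (suc q) zero    = z≤n
punchIn≤suc (suc q) (suc v) = s≤s (punchIn≤suc q v)

rank≤pred : ∀ {n} (r : Vec (Fin n) n) x → rank r x ≤ pred n
rank≤pred r x = toℕ≤pred[n] (lookup r x)

rank-cong : ∀ {n} {r s : Vec (Fin n) n} → r ≡ s → rank r ≗ rank s
rank-cong r≡s x = cong (λ v → rank v x) r≡s

rank-injective : ∀ {n} {r s : Vec (Fin n) n} → rank r ≗ rank s → r ≡ s
rank-injective r≗s = Pointwise-≡⇒≡ (ext (λ x → toℕ-injective (r≗s x)))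

fromRanking : ∀ {m} → (Fin (suc m) → ℕ) → Vec (Fin (suc m)) (suc m)
fromRanking {m} ρ = tabulate (λ x → ρ x mod suc m)

rank-fromRanking : ∀ {m} {ρ : Fin (suc m) → ℕ} → (∀ x → ρ x ≤ m) → rank (fromRanking ρ) ≗ ρ
rank-fromRanking {m} {ρ} ρ≤m x = begin
  toℕ (lookup (fromRanking ρ) x) ≡⟨ cong toℕ (lookup∘tabulate (λ y → ρ y mod suc m) x) ⟩
  toℕ (ρ x mod suc m)            ≡⟨ toℕ-fromℕ< _ ⟩
  ρ x % suc m                    ≡⟨ m<n⇒m%n≡m (s≤s (ρ≤m x)) ⟩
  ρ x                            ∎
  where open ≡-Reasoning

module FlipAtSecondLast {m} (a : Fin (suc m)) (label-a : label a ≡ m)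
  (A B : Subset (suc m)) (a∈A : lookup A a ≡ true) (a∉B : lookup B a ≡ false)
  (A≐B : ∀ j → j ≢ a → lookup A j ≡ lookup B j) where

  c : Fin (suc m)
  c = fromℕ m

  toℕ-c : toℕ c ≡ m
  toℕ-c = toℕ-fromℕ m

  c≡1+a : toℕ c ≡ suc (toℕ a)
  c≡1+a = trans toℕ-c (sym label-a)

  x≤c : ∀ (x : Fin (suc m)) → toℕ x ≤ toℕ c
  x≤c x = subst (toℕ x ≤_) (sym toℕ-c) (toℕ≤pred[n] x)

  a<c : toℕ a < toℕ c
  a<c = subst (toℕ a <_) (sym c≡1+a) (n<1+n (toℕ a))

  a<x⇒x≡c : ∀ {x : Fin (suc m)} → toℕ a < toℕ x → x ≡ c
  a<x⇒x≡c {x} a<x = toℕ-injective (≤-antisym (x≤c x) (subst (_≤ toℕ x) (sym c≡1+a) a<x))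

  <x⇒≢c : ∀ {w x : Fin (suc m)} → toℕ w < toℕ x → w ≢ c
  <x⇒≢c {w} {x} w<x refl = <⇒≱ w<x (x≤c x)

  x<a : ∀ {x : Fin (suc m)} → x ≢ a → x ≢ c → toℕ x < toℕ a
  x<a {x} x≢a x≢c = ≤∧≢⇒< (s≤s⁻¹ (subst (toℕ x <_) c≡1+a x<c)) (x≢a ∘ toℕ-injective)
    where
    x<c : toℕ x < toℕ c
    x<c = ≤∧≢⇒< (x≤c x) (x≢c ∘ toℕ-injective)

  Bounded : (Fin (suc m) → ℕ) → Set
  Bounded ρ = ∀ x → ρ x ≤ m

  module _ {ρ : Fin (suc m) → ℕ} where

    nothing-after-a-and-c : Respects A ρ → ∀ {x} → x ≢ a → x ≢ c → ¬ (ρ a < ρ x × ρ c < ρ x)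
    nothing-after-a-and-c resp x≢a x≢c =
      subst (λ b → Never b (ρ _) (ρ a) (ρ c)) a∈A (resp (x<a x≢a x≢c) a<c)

    later-of-a-c-is-last : Valid A ρ → Bounded ρ → ρ a ⊔ ρ c ≡ m
    later-of-a-c-is-last (inj , resp) bounded =
      ≤-antisym (⊔-lub (bounded a) (bounded c)) (s≤s⁻¹ (injective⇒≤bound inj (s≤s ∘ ≤a⊔c)))
      where
      ≤a⊔c : ∀ x → ρ x ≤ ρ a ⊔ ρ c
      ≤a⊔c x with x ≟ a | x ≟ c
      ... | yes refl | _        = m≤m⊔n (ρ a) (ρ c)
      ... | no _     | yes refl = m≤n⊔m (ρ a) (ρ c)
      ... | no x≢a   | no x≢c   = ≮⇒≥ λ a⊔c<x →
        nothing-after-a-and-c resp x≢a x≢c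
          (m⊔n<o⇒m<o (ρ a) (ρ c) a⊔c<x , m⊔n<o⇒n<o (ρ a) (ρ c) a⊔c<x)

    a-last : Valid A ρ → Bounded ρ → ρ c < ρ a → ρ a ≡ m
    a-last valid bounded c<a =
      trans (sym (m≥n⇒m⊔n≡m (<⇒≤ c<a))) (later-of-a-c-is-last valid bounded)

    c-last : Valid A ρ → Bounded ρ → ρ a < ρ c → ρ c ≡ m
    c-last valid bounded a<c =
      trans (sym (m≤n⇒m⊔n≡n (<⇒≤ a<c))) (later-of-a-c-is-last valid bounded)

    below-last : Injective _≡_ _≡_ ρ → Bounded ρ → ρ a ≡ m → ∀ {x} → x ≢ a → ρ x < m
    below-last inj bounded ρa≡m x≢a =
      ≤∧≢⇒< (bounded _) (λ ρx≡m → x≢a (inj (trans ρx≡m (sym ρa≡m))))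

  Movable : (Fin (suc m) → ℕ) → Set
  Movable ρ = ρ a ≡ m × suc (ρ c) < m

  movable? : ∀ ρ → Dec (Movable ρ)
  movable? ρ = (ρ a ≟ℕ m) ×-dec (suc (ρ c) <? m)

  respects-unless-movable : ∀ {ρ} → Valid A ρ → Bounded ρ → ¬ Movable ρ → Respects B ρ
  respects-unless-movable {ρ} valid@(inj , resp) bounded ¬movable {i} {j} {k} i<j j<k with j ≟ a
  ... | no j≢a = subst (λ b → Never b (ρ i) (ρ j) (ρ k)) (A≐B j j≢a) (resp i<j j<k)
  ... | yes refl with a<x⇒x≡c j<k
  ...   | refl = subst (λ b → Never b (ρ i) (ρ a) (ρ c)) (sym a∉B) λ (c<i , c<a) →
    let ρa≡m = a-last valid bounded c<a
        m≤1+c = ≮⇒≥ (¬movable ∘ (ρa≡m ,_))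
    in <⇒≱ (below-last inj bounded ρa≡m (<⇒≢ i<j)) (≤-trans m≤1+c c<i)

  -- a, which was last, takes the place of c; c and everything after it move up by one.
  move : (Fin (suc m) → ℕ) → Fin (suc m) → ℕ
  move ρ x with x ≟ a
  ... | yes _ = ρ c
  ... | no  _ = punchIn (ρ c) (ρ x)

  module _ {ρ : Fin (suc m) → ℕ} where

    move-a : move ρ a ≡ ρ c
    move-a with a ≟ a
    ... | yes _   = refl
    ... | no  a≢a = ⊥-elim (a≢a refl)

    move-≢a : ∀ {x} → x ≢ a → move ρ x ≡ punchIn (ρ c) (ρ x)
    move-≢a {x} x≢a with x ≟ a
    ... | yes x≡a = ⊥-elim (x≢a x≡a)
    ... | no  _   = refl

    move-c : move ρ c ≡ suc (ρ c)
    move-c = trans (move-≢a (<⇒≢ a<c ∘ sym)) (punchIn-self (ρ c))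

    move-injective : Injective _≡_ _≡_ ρ → Injective _≡_ _≡_ (move ρ)
    move-injective inj {x} {y} eq with x ≟ a | y ≟ a
    ... | yes x≡a | yes y≡a = trans x≡a (sym y≡a)
    ... | yes _   | no _    = ⊥-elim (punchInᵢ≢i (ρ c) (ρ y) (sym eq))
    ... | no _    | yes _   = ⊥-elim (punchInᵢ≢i (ρ c) (ρ x) eq)
    ... | no _    | no _    = inj (punchIn-injective (ρ c) eq)

    move-bounded : Injective _≡_ _≡_ ρ → Bounded ρ → Movable ρ → Bounded (move ρ)
    move-bounded inj bounded (ρa≡m , _) x with x ≟ a
    ... | yes _   = bounded c
    ... | no  x≢a = ≤-trans (punchIn≤suc (ρ c) (ρ x)) (below-last inj bounded ρa≡m x≢a)

    move-cancel-< : ∀ {x y} → x ≢ a → y ≢ a → move ρ x < move ρ y → ρ x < ρ y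
    move-cancel-< x≢a y≢a = punchIn-cancel-< (ρ c) ∘ subst₂ _<_ (move-≢a x≢a) (move-≢a y≢a)

    move-a< : Injective _≡_ _≡_ ρ → ∀ {x} → x ≢ a → x ≢ c → move ρ a < move ρ x → ρ c < ρ x
    move-a< inj {x} x≢a x≢c a<x =
      ≤∧≢⇒< (i<punchIn⇒i≤ (ρ c) (ρ x) (subst₂ _<_ move-a (move-≢a x≢a) a<x)) (x≢c ∘ inj ∘ sym)

    move-respects : Valid A ρ → Respects B (move ρ)
    move-respects (inj , resp) {i} {j} {k} i<j j<k = by-j (j ≟ a)
      where
      by-j : Dec (j ≡ a) → Never (lookup B j) (move ρ i) (move ρ j) (move ρ k)
      by-j (yes refl) with a<x⇒x≡c j<k
      ... | refl = subst (λ b → Never b (move ρ i) (move ρ a) (move ρ c)) (sym a∉B) λ (_ , c<a) →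
        <-asym c<a (subst₂ _<_ (sym move-a) (sym move-c) (n<1+n (ρ c)))
      by-j (no j≢a) =
        subst (λ b → Never b (move ρ i) (move ρ j) (move ρ k)) (A≐B j j≢a) (by-k (k ≟ a))
        where
        j≢c : j ≢ c
        j≢c = <x⇒≢c j<k
        i≢a : i ≢ a
        i≢a refl = j≢c (a<x⇒x≡c i<j)
        -- move ρ preserves the order away from a, and a stands where c stood under ρ.
        by-k : Dec (k ≡ a) → Never (lookup A j) (move ρ i) (move ρ j) (move ρ k)
        by-k (yes refl) = Never-mono (lookup A j)
          (move-cancel-< j≢a i≢a) (move-a< inj i≢a (<x⇒≢c i<j)) (move-a< inj j≢a j≢c)
          (resp i<j (<-trans j<k a<c))
        by-k (no k≢a) = Never-mono (lookup A j)
          (move-cancel-< j≢a i≢a) (move-cancel-< k≢a i≢a) (move-cancel-< k≢a j≢a)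
          (resp i<j j<k)

  move-cancel : ∀ {ρ ρ′} → Movable ρ → Movable ρ′ → move ρ ≗ move ρ′ → ρ ≗ ρ′
  move-cancel {ρ} {ρ′} (ρa≡m , _) (ρ′a≡m , _) eq x with x ≟ a
  ... | yes refl = trans ρa≡m (sym ρ′a≡m)
  ... | no  x≢a  = punchIn-injective (ρ c) (begin
    punchIn (ρ c) (ρ x)   ≡⟨ move-≢a x≢a ⟨
    move ρ x              ≡⟨ eq x ⟩
    move ρ′ x             ≡⟨ move-≢a x≢a ⟩
    punchIn (ρ′ c) (ρ′ x) ≡⟨ cong (λ q → punchIn q (ρ′ x)) ρ′c≡ρc ⟩
    punchIn (ρ c) (ρ′ x)  ∎)
    where
    open ≡-Reasoning
    ρ′c≡ρc : ρ′ c ≡ ρ c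
    ρ′c≡ρc = trans (sym move-a) (trans (sym (eq a)) move-a)

  moved-not-valid : ∀ {ρ ρ′} → Movable ρ → ρ′ ≗ move ρ → Bounded ρ′ → ¬ Valid A ρ′
  moved-not-valid {ρ} {ρ′} (_ , 1+c<m) ρ′≗ bounded valid = <⇒≢ℕ 1+c<m (begin
    suc (ρ c) ≡⟨ move-c ⟨
    move ρ c  ≡⟨ ρ′≗ c ⟨
    ρ′ c      ≡⟨ c-last valid bounded a<c′ ⟩
    m         ∎)
    where
    open ≡-Reasoning
    a<c′ : ρ′ a < ρ′ c
    a<c′ = subst₂ _<_ (sym (trans (ρ′≗ a) move-a)) (sym (trans (ρ′≗ c) move-c)) (n<1+n (ρ c))

  embed : Vec (Fin (suc m)) (suc m) → Vec (Fin (suc m)) (suc m)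
  embed r with movable? (rank r)
  ... | yes _ = fromRanking (move (rank r))
  ... | no  _ = r

  rank-moved : ∀ r → Valid A (rank r) → Movable (rank r) →
    rank (fromRanking (move (rank r))) ≗ move (rank r)
  rank-moved r (inj , _) movable = rank-fromRanking (move-bounded inj (rank≤pred r) movable)

  embed-valid : ∀ {r} → Valid A (rank r) → Valid B (rank (embed r))
  embed-valid {r} valid@(inj , _) with movable? (rank r)
  ... | yes movable = Valid-resp-≗ {B = B} (sym ∘ rank-moved r valid movable)
                        (move-injective inj , move-respects valid)
  ... | no ¬movable = inj , respects-unless-movable valid (rank≤pred r) ¬movable

  embed-injective : ∀ {r s} → Valid A (rank r) → Valid A (rank s) → embed r ≡ embed s → r ≡ s
  embed-injective {r} {s} valid-r valid-s eq with movable? (rank r) | movable? (rank s)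
  ... | yes mr | yes ms = rank-injective (move-cancel mr ms λ x →
    trans (sym (rank-moved r valid-r mr x)) (trans (rank-cong eq x) (rank-moved s valid-s ms x)))
  ... | yes mr | no _  = ⊥-elim (moved-not-valid mr
    (λ x → trans (rank-cong (sym eq) x) (rank-moved r valid-r mr x)) (rank≤pred s) valid-s)
  ... | no _  | yes ms = ⊥-elim (moved-not-valid ms
    (λ x → trans (rank-cong eq x) (rank-moved s valid-s ms x)) (rank≤pred r) valid-r)
  ... | no _  | no _  = eq

  f≤f : f (suc m) A ≤ f (suc m) B
  f≤f = injection⇒f≤f {A = A} {B} embed (λ {r} → embed-valid {r})
          (λ {r} {s} → embed-injective {r} {s})

Never-dual : ∀ b {x y z x′ y′ z′} →
  (y′ < x′ → z < y) → (z′ < x′ → z < x) → (z′ < y′ → y < x) →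
  Never b x y z → Never (not b) x′ y′ z′
Never-dual true  zy zx yx never (z′<x′ , z′<y′) = never (yx z′<y′ , zx z′<x′)
Never-dual false zy zx yx never (y′<x′ , z′<x′) = never (zx z′<x′ , zy y′<x′)

opposite-injective : ∀ {n} {x y : Fin n} → opposite x ≡ opposite y → x ≡ y
opposite-injective {x = x} {y} eq =
  trans (sym (opposite-involutive x)) (trans (cong opposite eq) (opposite-involutive y))

opposite-reverses-< : ∀ {n} {x y : Fin n} → toℕ x < toℕ y → toℕ (opposite y) < toℕ (opposite x)
opposite-reverses-< {n} {x} {y} x<y = subst₂ _<_ (sym (opposite-prop y)) (sym (opposite-prop x))
  (∸-monoʳ-< (s≤s x<y) (toℕ<n y))

-- The scheme satisfied by the reversed orders after relabelling x ↦ opposite x.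
dual : ∀ {n} → Subset n → Subset n
dual A = tabulate (λ j → not (lookup A (opposite j)))

lookup-dual : ∀ {n} (A : Subset n) j → lookup (dual A) j ≡ not (lookup A (opposite j))
lookup-dual A = lookup∘tabulate (λ j → not (lookup A (opposite j)))

dual-involutive : ∀ {n} (A : Subset n) → dual (dual A) ≡ A
dual-involutive A = Pointwise-≡⇒≡ (ext λ j → begin
  lookup (dual (dual A)) j                     ≡⟨ lookup-dual (dual A) j ⟩
  not (lookup (dual A) (opposite j))           ≡⟨ cong not (lookup-dual A (opposite j)) ⟩
  not (not (lookup A (opposite (opposite j)))) ≡⟨ not-involutive _ ⟩
  lookup A (opposite (opposite j))             ≡⟨ cong (lookup A) (opposite-involutive j) ⟩
  lookup A j                                   ∎)
  where open ≡-Reasoning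

lookup-dual-opposite : ∀ {n} (A : Subset n) x → lookup (dual A) (opposite x) ≡ not (lookup A x)
lookup-dual-opposite A x =
  trans (lookup-dual A (opposite x)) (cong (not ∘ lookup A) (opposite-involutive x))

dual-agrees : ∀ {n} {A B : Subset n} {y} → (∀ x → x ≢ y → lookup A x ≡ lookup B x) →
  ∀ j → j ≢ opposite y → lookup (dual A) j ≡ lookup (dual B) j
dual-agrees {A = A} {B} {y} agree j j≢y′ = begin
  lookup (dual A) j           ≡⟨ lookup-dual A j ⟩
  not (lookup A (opposite j)) ≡⟨ cong not (agree (opposite j) opposite-j≢y) ⟩
  not (lookup B (opposite j)) ≡⟨ lookup-dual B j ⟨
  lookup (dual B) j           ∎
  where
  open ≡-Reasoning
  opposite-j≢y : opposite j ≢ y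
  opposite-j≢y e = j≢y′ (opposite-injective (trans e (sym (opposite-involutive y))))

mirror : ∀ {n} → Vec (Fin n) n → Vec (Fin n) n
mirror r = tabulate (λ x → opposite (lookup r (opposite x)))

lookup-mirror : ∀ {n} (r : Vec (Fin n) n) x → lookup (mirror r) x ≡ opposite (lookup r (opposite x))
lookup-mirror r = lookup∘tabulate (λ x → opposite (lookup r (opposite x)))

mirror-involutive : ∀ {n} (r : Vec (Fin n) n) → mirror (mirror r) ≡ r
mirror-involutive r = Pointwise-≡⇒≡ (ext λ x → begin
  lookup (mirror (mirror r)) x                           ≡⟨ lookup-mirror (mirror r) x ⟩
  opposite (lookup (mirror r) (opposite x))              ≡⟨ cong opposite (lookup-mirror r _) ⟩
  opposite (opposite (lookup r (opposite (opposite x)))) ≡⟨ opposite-involutive _ ⟩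
  lookup r (opposite (opposite x))                       ≡⟨ cong (lookup r) (opposite-involutive x) ⟩
  lookup r x                                             ∎)
  where open ≡-Reasoning

mirror-cancel-< : ∀ {n} (r : Vec (Fin n) n) {x y} →
  rank (mirror r) x < rank (mirror r) y → rank r (opposite y) < rank r (opposite x)
mirror-cancel-< {n} r {x} {y} =
  s<s⁻¹ ∘ ∸-cancelʳ-< {o = n} ∘ subst₂ _<_ (rank-mirror x) (rank-mirror y)
  where
  rank-mirror : ∀ x → rank (mirror r) x ≡ n ∸ suc (rank r (opposite x))
  rank-mirror x = trans (cong toℕ (lookup-mirror r x)) (opposite-prop (lookup r (opposite x)))

mirror-valid : ∀ {n} {A : Subset n} {r} → Valid A (rank r) → Valid (dual A) (rank (mirror r))
mirror-valid {A = A} {r} (inj , resp) = inj′ , resp′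
  where
  ρ′ : Fin _ → ℕ
  ρ′ = rank (mirror r)
  inj′ : Injective _≡_ _≡_ ρ′
  inj′ {x} {y} eq = opposite-injective (inj (cong toℕ (opposite-injective
    (trans (sym (lookup-mirror r x)) (trans (toℕ-injective eq) (lookup-mirror r y))))))
  resp′ : Respects (dual A) ρ′
  resp′ {i} {j} {k} i<j j<k = subst (λ b → Never b (ρ′ i) (ρ′ j) (ρ′ k)) (sym (lookup-dual A j))
    (Never-dual (lookup A (opposite j)) (mirror-cancel-< r) (mirror-cancel-< r) (mirror-cancel-< r)
      (resp (opposite-reverses-< j<k) (opposite-reverses-< i<j)))

f≤f-dual : ∀ {n} (A : Subset n) → f n A ≤ f n (dual A)
f≤f-dual A = injection⇒f≤f {A = A} {dual A} mirror (λ {r} → mirror-valid {A = A} {r})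
  λ {r} {s} _ _ eq → trans (sym (mirror-involutive r)) (trans (cong mirror eq) (mirror-involutive s))

lookup-─⁅x⁆ : ∀ {n} (A : Subset n) x → lookup (A ─ ⁅ x ⁆) x ≡ false
lookup-─⁅x⁆ (_ ∷ A) zero    = refl
lookup-─⁅x⁆ (_ ∷ A) (suc x) = lookup-─⁅x⁆ A x

lookup-─⁅y⁆ : ∀ {n} (A : Subset n) {x y} → x ≢ y → lookup (A ─ ⁅ y ⁆) x ≡ lookup A x
lookup-─⁅y⁆ (_ ∷ A) {zero}  {zero}  x≢y = ⊥-elim (x≢y refl)
lookup-─⁅y⁆ (_ ∷ A) {zero}  {suc y} x≢y = refl
lookup-─⁅y⁆ (_ ∷ A) {suc x} {zero}  x≢y = cong (λ B → lookup B x) (p─⊥≡p A)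
lookup-─⁅y⁆ (_ ∷ A) {suc x} {suc y} x≢y = lookup-─⁅y⁆ A (x≢y ∘ cong suc)

lookup-∪⁅y⁆ : ∀ {n} (A : Subset n) {x y} → x ≢ y → lookup (A ∪ ⁅ y ⁆) x ≡ lookup A x
lookup-∪⁅y⁆ (_ ∷ A) {zero}  {zero}  x≢y = ⊥-elim (x≢y refl)
lookup-∪⁅y⁆ (u ∷ A) {zero}  {suc y} x≢y = ∨-identityʳ u
lookup-∪⁅y⁆ (_ ∷ A) {suc x} {zero}  x≢y = cong (λ B → lookup B x) (∪-identityʳ A)
lookup-∪⁅y⁆ (_ ∷ A) {suc x} {suc y} x≢y = lookup-∪⁅y⁆ A (x≢y ∘ cong suc)

∉⇒lookup≡false : ∀ {n} {A : Subset n} {x} → x ∉ A → lookup A x ≡ false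
∉⇒lookup≡false {A = A} {x} x∉A with lookup A x in eq
... | true  = ⊥-elim (x∉A (lookup⇒[]= x A eq))
... | false = refl

remove-second-last : ∀ {n} (A : Subset n) (a : Fin n) → label a ≡ n ∸ 1 → a ∈ A →
  f n A ≤ f n (A ─ ⁅ a ⁆)
remove-second-last {suc m} A a label-a a∈A = FlipAtSecondLast.f≤f a label-a A (A ─ ⁅ a ⁆)
  ([]=⇒lookup a∈A) (lookup-─⁅x⁆ A a) (λ j j≢a → sym (lookup-─⁅y⁆ A j≢a))

add-second : ∀ {n} (A : Subset n) (b : Fin n) → label b ≡ 2 → b ∉ A → f n A ≤ f n (A ∪ ⁅ b ⁆)
add-second A zero          ()
add-second A (suc (suc _)) ()
add-second {n} A b@(suc zero) refl b∉A = begin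
  f n A                         ≤⟨ f≤f-dual A ⟩
  f n (dual A)                  ≤⟨ FlipAtSecondLast.f≤f (opposite b) (cong suc (opposite-prop b))
                                     (dual A) (dual (A ∪ ⁅ b ⁆)) b-flipped-in b-flipped-out agree ⟩
  f n (dual (A ∪ ⁅ b ⁆))        ≤⟨ f≤f-dual (dual (A ∪ ⁅ b ⁆)) ⟩
  f n (dual (dual (A ∪ ⁅ b ⁆))) ≡⟨ cong (f n) (dual-involutive (A ∪ ⁅ b ⁆)) ⟩
  f n (A ∪ ⁅ b ⁆)               ∎
  where
  open ≤-Reasoning
  b-flipped-in : lookup (dual A) (opposite b) ≡ true
  b-flipped-in = trans (lookup-dual-opposite A b) (cong not (∉⇒lookup≡false b∉A))
  b-flipped-out : lookup (dual (A ∪ ⁅ b ⁆)) (opposite b) ≡ false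
  b-flipped-out = trans (lookup-dual-opposite (A ∪ ⁅ b ⁆) b)
    (cong not ([]=⇒lookup (x∈p∪q⁺ {p = A} (inj₂ (x∈⁅x⁆ b)))))
  agree : ∀ j → j ≢ opposite b → lookup (dual A) j ≡ lookup (dual (A ∪ ⁅ b ⁆)) j
  agree = dual-agrees {A = A} {A ∪ ⁅ b ⁆} {b} (λ x x≢b → sym (lookup-∪⁅y⁆ A x≢b))

mainTheorem8 : (n : ℕ) → 3 ≤ n → (A : Subset n) →
    ((a : Fin n) → label a ≡ n ∸ 1 → a ∈ A → f n A ≤ f n (A ─ ⁅ a ⁆))
    × ((b : Fin n) → label b ≡ 2 → b ∉ A → f n A ≤ f n (A ∪ ⁅ b ⁆))
mainTheorem8 n _ A = remove-second-last A , add-second A
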